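{- Let $G$ be a graph, $k\ge1$, and $S,T$ independent sets of $G$ of size $k$. Let $\mathcal{F}$ be a family of independent sets of $G$, each of size at least $k$, with $S,T\in\mathcal{F}$. Let $\mathcal{G}$ be the graph with one vertex for each member of $\mathcal{F}$, where the vertices of $I,I'\in\mathcal{F}$ are adjacent iff $|I\cap I'|\ge k-1$, and let $i_s,i_t$ be the vertices of $S$ and $T$. If there is a path from $i_s$ to $i_t$ in $\mathcal{G}$, then there is a sequence of token jumps transforming $S$ into $T$ in $G$.
   Context: A set is independent if its vertices are pairwise non-adjacent. A token jump transforms an independent set $I$ into $(I\setminus\{u\})\cup\{w\}$ with $u\in I$, $w\in V(G)\setminus I$, and the result independent. (In the paper, $\mathcal{F}$ arises from an independence covering family for $(G,k)$ after removing sets of size less than $k$ and adding $S,T$.) -}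

module Defs where

open import Data.Nat using (ℕ; suc; _∸_; _≥_)
open import Data.Fin using (Fin)
open import Data.Fin.Subset using (Subset; _∈_; _∉_; _∩_; _∪_; _-_; ⁅_⁆; ∣_∣)
open import Data.List using (List; []; _∷_; length; lookup)
open import Data.Product using (Σ; _×_; ∃; ∃₂)
open import Relation.Binary.PropositionalEquality using (_≡_)
open import Relation.Nullary using (¬_)

record Graph (n : ℕ) : Set₁ where
  field
    Adj       : Fin n → Fin n → Set
    Adj-sym   : ∀ {u v} → Adj u v → Adj v u
    Adj-irrefl : ∀ {u} → ¬ Adj u u
open Graph public

Independent : ∀ {n} → Graph n → Subset n → Set
Independent G I = ∀ u v → u ∈ I → v ∈ I → ¬ Adj G u v

TokenJump : ∀ {n} → Graph n → Subset n → Subset n → Set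
TokenJump G I J =
  ∃₂ λ u w → u ∈ I × w ∉ I × J ≡ ((I - u) ∪ ⁅ w ⁆) × Independent G J

data TJSeq {n} (G : Graph n) : Subset n → Subset n → Set where
  done : ∀ {I} → TJSeq G I I
  step : ∀ {I J K} → TokenJump G I J → TJSeq G J K → TJSeq G I K

𝒢Adj : ∀ {n} (k : ℕ) (ℱ : List (Subset n)) → Fin (length ℱ) → Fin (length ℱ) → Set
𝒢Adj k ℱ i j = ¬ (i ≡ j) × ∣ lookup ℱ i ∩ lookup ℱ j ∣ ≥ k ∸ 1

data 𝒢Path {n} (k : ℕ) (ℱ : List (Subset n)) : Fin (length ℱ) → Fin (length ℱ) → Set where
  here  : ∀ {i} → 𝒢Path k ℱ i i
  there : ∀ {i j l} → 𝒢Adj k ℱ i j → 𝒢Path k ℱ j l → 𝒢Path k ℱ i l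

-- Any two k-subsets of one independent set are joined by token jumps, because every
-- intermediate set stays inside that independent set. Across an edge I – I' of 𝒢 choose
-- C ⊆ I ∩ I' with |C| = k − 1, x ∈ I ∖ C and y ∈ I' ∖ C: move the tokens inside I onto
-- C ∪ {x}, jump x to y, and continue inside I'.
module Submission where

open import Defs
open import Data.Nat using (ℕ; zero; suc; _≥_; _≤_; _<_; s≤s)
open import Data.Nat.Properties using (≤-trans; ≤-reflexive; n≤1+n; suc-injective)
open import Data.Bool using (Bool; true; false)
open import Data.Bool.Properties using (∨-identityʳ)
open import Data.Fin using (Fin; zero; suc; _≟_)
open import Data.Fin.Subset using (Subset; ∣_∣; _∈_; _∉_; _⊆_; _∩_; _∪_; _-_; ⁅_⁆; ⊥)
open import Data.Fin.Subset.Properties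
  using (drop-∷-⊆; ⊆-reflexive; p∩q⊆p; p∩q⊆q; p─q⊆p; p─⊥≡p; ∪-identityʳ; ∉⊥; ∣⊥∣≡0;
         x∈p∪q⁺; x∈p∪q⁻; x∈⁅x⁆; x∈⁅y⁆⇒x≡y)
open import Data.Vec using ([]; _∷_; here; there)
open import Data.List using (List; length; lookup)
open import Data.Product using (_×_; _,_; ∃; ∃₂)
open import Data.Sum using (inj₁; inj₂; [_,_])
open import Function using (_∘_)
open import Level using (0ℓ)
open import Relation.Binary using (Rel)
open import Relation.Binary.Construct.Closure.ReflexiveTransitive using (Star; ε; _◅_; _◅◅_; gmap; fold)
open import Relation.Nullary using (yes; no; contradiction)
open import Relation.Binary.PropositionalEquality using (_≡_; refl; sym; trans; cong; cong₂; subst)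

∣p∣<∣q∣⇒∃∈q∉p : ∀ {n} (p q : Subset n) → ∣ p ∣ < ∣ q ∣ → ∃ λ x → x ∈ q × x ∉ p
∣p∣<∣q∣⇒∃∈q∉p (false ∷ p) (true ∷ q) _ = zero , here , λ ()
∣p∣<∣q∣⇒∃∈q∉p (true ∷ p) (true ∷ q) (s≤s lt) with ∣p∣<∣q∣⇒∃∈q∉p p q lt
... | x , x∈q , x∉p = suc x , there x∈q , λ { (there x∈p) → x∉p x∈p }
∣p∣<∣q∣⇒∃∈q∉p (false ∷ p) (false ∷ q) lt with ∣p∣<∣q∣⇒∃∈q∉p p q lt
... | x , x∈q , x∉p = suc x , there x∈q , λ { (there x∈p) → x∉p x∈p }
∣p∣<∣q∣⇒∃∈q∉p (true ∷ p) (false ∷ q) lt with ∣p∣<∣q∣⇒∃∈q∉p p q (≤-trans (n≤1+n _) lt)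
... | x , x∈q , x∉p = suc x , there x∈q , λ { (there x∈p) → x∉p x∈p }

x∉p⇒∣p∪⁅x⁆∣≡1+∣p∣ : ∀ {n} (p : Subset n) (x : Fin n) → x ∉ p → ∣ p ∪ ⁅ x ⁆ ∣ ≡ suc ∣ p ∣
x∉p⇒∣p∪⁅x⁆∣≡1+∣p∣ (false ∷ p) zero    _   = cong (suc ∘ ∣_∣) (∪-identityʳ p)
x∉p⇒∣p∪⁅x⁆∣≡1+∣p∣ (true ∷ p)  zero    x∉p = contradiction here x∉p
x∉p⇒∣p∪⁅x⁆∣≡1+∣p∣ (false ∷ p) (suc x) x∉p = x∉p⇒∣p∪⁅x⁆∣≡1+∣p∣ p x (x∉p ∘ there)
x∉p⇒∣p∪⁅x⁆∣≡1+∣p∣ (true ∷ p)  (suc x) x∉p = cong suc (x∉p⇒∣p∪⁅x⁆∣≡1+∣p∣ p x (x∉p ∘ there))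

x∈p⇒1+∣p-x∣≡∣p∣ : ∀ {n} (p : Subset n) (x : Fin n) → x ∈ p → suc ∣ p - x ∣ ≡ ∣ p ∣
x∈p⇒1+∣p-x∣≡∣p∣ (true ∷ p)  zero    here        = cong (suc ∘ ∣_∣) (p─⊥≡p p)
x∈p⇒1+∣p-x∣≡∣p∣ (false ∷ p) (suc x) (there x∈p) = x∈p⇒1+∣p-x∣≡∣p∣ p x x∈p
x∈p⇒1+∣p-x∣≡∣p∣ (true ∷ p)  (suc x) (there x∈p) = cong suc (x∈p⇒1+∣p-x∣≡∣p∣ p x x∈p)

x∉p⇒p∪⁅x⁆-x≡p : ∀ {n} (p : Subset n) (x : Fin n) → x ∉ p → p ∪ ⁅ x ⁆ - x ≡ p
x∉p⇒p∪⁅x⁆-x≡p (false ∷ p) zero    _   = cong (false ∷_) (trans (p─⊥≡p (p ∪ ⊥)) (∪-identityʳ p))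
x∉p⇒p∪⁅x⁆-x≡p (true ∷ p)  zero    x∉p = contradiction here x∉p
x∉p⇒p∪⁅x⁆-x≡p (a ∷ p)     (suc x) x∉p =
  cong₂ _∷_ (∨-identityʳ a) (x∉p⇒p∪⁅x⁆-x≡p p x (x∉p ∘ there))

∃-⊆-∣∣≡ : ∀ {n} (p : Subset n) (m : ℕ) → ∣ p ∣ ≥ m → ∃ λ q → q ⊆ p × ∣ q ∣ ≡ m
∃-⊆-∣∣≡ {n} p zero _ = ⊥ , (λ x∈⊥ → contradiction x∈⊥ ∉⊥) , ∣⊥∣≡0 n
∃-⊆-∣∣≡ (false ∷ p) (suc m) ∣p∣≥m with ∃-⊆-∣∣≡ p (suc m) ∣p∣≥m
... | q , q⊆p , ∣q∣≡m = false ∷ q , (λ { (there x∈q) → there (q⊆p x∈q) }) , ∣q∣≡m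
∃-⊆-∣∣≡ (true ∷ p) (suc m) (s≤s ∣p∣≥m) with ∃-⊆-∣∣≡ p m ∣p∣≥m
... | q , q⊆p , ∣q∣≡m =
  true ∷ q , (λ { here → here ; (there x∈q) → there (q⊆p x∈q) }) , cong suc ∣q∣≡m

p∪⁅x⁆⊆q : ∀ {n} {p q : Subset n} {x : Fin n} → p ⊆ q → x ∈ q → p ∪ ⁅ x ⁆ ⊆ q
p∪⁅x⁆⊆q {p = p} {q} {x} p⊆q x∈q y∈p∪⁅x⁆ with x∈p∪q⁻ p ⁅ x ⁆ y∈p∪⁅x⁆
... | inj₁ y∈p  = p⊆q y∈p
... | inj₂ y∈⁅x⁆ = subst (_∈ q) (sym (x∈⁅y⁆⇒x≡y x y∈⁅x⁆)) x∈q

∷-⊆-∷ : ∀ {n} {a z : Bool} {p q r : Subset n} → (a ∷ p) ⊆ (z ∷ r) → q ⊆ r → (a ∷ q) ⊆ (z ∷ r)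
∷-⊆-∷ ap⊆zr q⊆r here         = ap⊆zr here
∷-⊆-∷ ap⊆zr q⊆r (there x∈q) = there (q⊆r x∈q)

-- TokenJump G is Jump (Independent G) on the nose; abstracting the target condition lets
-- the induction over the vertices pass to a tail of the vertex set.
Jump : ∀ {n} → (Subset n → Set) → Rel (Subset n) 0ℓ
Jump Ok I J = ∃₂ λ u w → u ∈ I × w ∉ I × J ≡ ((I - u) ∪ ⁅ w ⁆) × Ok J

Jumps : ∀ {n} → (Subset n → Set) → Rel (Subset n) 0ℓ
Jumps Ok = Star (Jump Ok)

∷-jump : ∀ {n} {Ok : Subset (suc n) → Set} (a : Bool) {I J : Subset n} →
  Jump (Ok ∘ (a ∷_)) I J → Jump Ok (a ∷ I) (a ∷ J)
∷-jump a (u , w , u∈I , w∉I , refl , ok) =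
  suc u , suc w , there u∈I , (λ { (there w∈I) → w∉I w∈I }) , cong (_∷ _) (sym (∨-identityʳ a)) , ok

∷-jumps : ∀ {n} {Ok : Subset (suc n) → Set} (a : Bool) {I J : Subset n} →
  Jumps (Ok ∘ (a ∷_)) I J → Jumps Ok (a ∷ I) (a ∷ J)
∷-jumps {Ok = Ok} a = gmap (a ∷_) (∷-jump {Ok = Ok} a)

align-head : ∀ {n} {Ok : Subset (suc n) → Set} {z a b : Bool} {Z A B : Subset n} →
  (∀ {X} → X ⊆ z ∷ Z → Ok X) → a ∷ A ⊆ z ∷ Z → b ∷ B ⊆ z ∷ Z → ∣ a ∷ A ∣ ≡ ∣ b ∷ B ∣ →
  ∃ λ A' → Jumps Ok (a ∷ A) (b ∷ A') × A' ⊆ Z × ∣ A' ∣ ≡ ∣ B ∣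
align-head {a = false} {false} ok A⊆ B⊆ eq = _ , ε , drop-∷-⊆ A⊆ , eq
align-head {a = true}  {true}  ok A⊆ B⊆ eq = _ , ε , drop-∷-⊆ A⊆ , suc-injective eq
align-head {a = true}  {false} {Z} {A} {B} ok A⊆ B⊆ eq with ∣p∣<∣q∣⇒∃∈q∉p A B (≤-reflexive eq)
... | w , w∈B , w∉A =
  A ∪ ⁅ w ⁆ ,
  (zero , suc w , here , (λ { (there w∈A) → w∉A w∈A }) ,
     cong (λ X → false ∷ (X ∪ ⁅ w ⁆)) (sym (p─⊥≡p A)) , ok (λ { (there x) → there (A'⊆Z x) })) ◅ ε ,
  A'⊆Z ,
  trans (x∉p⇒∣p∪⁅x⁆∣≡1+∣p∣ A w w∉A) eq
  where
  A'⊆Z : A ∪ ⁅ w ⁆ ⊆ Z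
  A'⊆Z = p∪⁅x⁆⊆q (drop-∷-⊆ A⊆) (drop-∷-⊆ B⊆ w∈B)
align-head {a = false} {true}  {Z} {A} {B} ok A⊆ B⊆ eq with ∣p∣<∣q∣⇒∃∈q∉p B A (≤-reflexive (sym eq))
... | u , u∈A , u∉B =
  A - u ,
  (suc u , zero , there u∈A , (λ ()) ,
     cong (true ∷_) (sym (∪-identityʳ (A - u))) , ok (∷-⊆-∷ B⊆ A'⊆Z)) ◅ ε ,
  A'⊆Z ,
  suc-injective (trans (x∈p⇒1+∣p-x∣≡∣p∣ A u u∈A) eq)
  where
  A'⊆Z : A - u ⊆ Z
  A'⊆Z = drop-∷-⊆ A⊆ ∘ p─q⊆p A ⁅ u ⁆

jumps-between-subsets : ∀ {n} {Ok : Subset n → Set} {Z A B : Subset n} →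
  (∀ {X} → X ⊆ Z → Ok X) → A ⊆ Z → B ⊆ Z → ∣ A ∣ ≡ ∣ B ∣ → Jumps Ok A B
jumps-between-subsets {Z = []} {[]} {[]} _ _ _ _ = ε
jumps-between-subsets {Z = z ∷ Z} {a ∷ A} {b ∷ B} ok A⊆ B⊆ eq with align-head ok A⊆ B⊆ eq
... | A' , A↝A' , A'⊆Z , ∣A'∣≡∣B∣ =
  A↝A' ◅◅ ∷-jumps b (jumps-between-subsets (ok ∘ ∷-⊆-∷ B⊆) A'⊆Z (drop-∷-⊆ B⊆) ∣A'∣≡∣B∣)

exchange : ∀ {n} {Ok : Subset n → Set} {C : Subset n} {x y : Fin n} →
  x ∉ C → y ∉ C → Ok (C ∪ ⁅ y ⁆) → Jumps Ok (C ∪ ⁅ x ⁆) (C ∪ ⁅ y ⁆)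
exchange {C = C} {x} {y} x∉C y∉C ok with x ≟ y
... | yes refl = ε
... | no x≢y = (x , y , x∈C∪⁅x⁆ , y∉C∪⁅x⁆ , cong (_∪ ⁅ y ⁆) (sym (x∉p⇒p∪⁅x⁆-x≡p C x x∉C)) , ok) ◅ ε
  where
  x∈C∪⁅x⁆ = x∈p∪q⁺ (inj₂ (x∈⁅x⁆ x))
  y∉C∪⁅x⁆ = [ y∉C , x≢y ∘ sym ∘ x∈⁅y⁆⇒x≡y x ] ∘ x∈p∪q⁻ C ⁅ x ⁆

module _ {n} (G : Graph n) where

  TokenJumps : Rel (Subset n) 0ℓ
  TokenJumps = Star (TokenJump G)

  independent-⊆ : ∀ {X Z} → X ⊆ Z → Independent G Z → Independent G X
  independent-⊆ X⊆Z indZ u v u∈X v∈X = indZ u v (X⊆Z u∈X) (X⊆Z v∈X)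

  jumps-inside-independent : ∀ {Z A B} → Independent G Z →
    A ⊆ Z → B ⊆ Z → ∣ A ∣ ≡ ∣ B ∣ → TokenJumps A B
  jumps-inside-independent indZ = jumps-between-subsets (λ X⊆Z → independent-⊆ X⊆Z indZ)

  jumps-across : ∀ {k I I' A B} → Independent G I → Independent G I' →
    ∣ I ∣ ≥ suc k → ∣ I' ∣ ≥ suc k → ∣ I ∩ I' ∣ ≥ k →
    A ⊆ I → ∣ A ∣ ≡ suc k → B ⊆ I' → ∣ B ∣ ≡ suc k → TokenJumps A B
  jumps-across {k} {I} {I'} indI indI' ∣I∣≥ ∣I'∣≥ ∣I∩I'∣≥ A⊆I ∣A∣≡ B⊆I' ∣B∣≡
    with ∃-⊆-∣∣≡ (I ∩ I') k ∣I∩I'∣≥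
  ... | C , C⊆I∩I' , ∣C∣≡k
    with ∣p∣<∣q∣⇒∃∈q∉p C I (subst (λ c → suc c ≤ ∣ I ∣) (sym ∣C∣≡k) ∣I∣≥)
       | ∣p∣<∣q∣⇒∃∈q∉p C I' (subst (λ c → suc c ≤ ∣ I' ∣) (sym ∣C∣≡k) ∣I'∣≥)
  ... | x , x∈I , x∉C | y , y∈I' , y∉C =
    jumps-inside-independent indI A⊆I C∪⁅x⁆⊆I (trans ∣A∣≡ (sym (∣C∪⁅_⁆∣ x∉C)))
    ◅◅ exchange x∉C y∉C (independent-⊆ C∪⁅y⁆⊆I' indI')
    ◅◅ jumps-inside-independent indI' C∪⁅y⁆⊆I' B⊆I' (trans (∣C∪⁅_⁆∣ y∉C) (sym ∣B∣≡))
    where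
    C∪⁅x⁆⊆I : C ∪ ⁅ x ⁆ ⊆ I
    C∪⁅x⁆⊆I = p∪⁅x⁆⊆q (p∩q⊆p I I' ∘ C⊆I∩I') x∈I
    C∪⁅y⁆⊆I' : C ∪ ⁅ y ⁆ ⊆ I'
    C∪⁅y⁆⊆I' = p∪⁅x⁆⊆q (p∩q⊆q I I' ∘ C⊆I∩I') y∈I'
    ∣C∪⁅_⁆∣ : ∀ {v} → v ∉ C → ∣ C ∪ ⁅ v ⁆ ∣ ≡ suc k
    ∣C∪⁅_⁆∣ {v} v∉C = trans (x∉p⇒∣p∪⁅x⁆∣≡1+∣p∣ C v v∉C) (cong suc ∣C∣≡k)

  jumps-along : ∀ {k} {ℱ : List (Subset n)} {i j A B} →
    (∀ i → Independent G (lookup ℱ i)) → (∀ i → ∣ lookup ℱ i ∣ ≥ suc k) →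
    𝒢Path (suc k) ℱ i j →
    A ⊆ lookup ℱ i → ∣ A ∣ ≡ suc k → B ⊆ lookup ℱ j → ∣ B ∣ ≡ suc k → TokenJumps A B
  jumps-along ind size here A⊆ ∣A∣≡ B⊆ ∣B∣≡ =
    jumps-inside-independent (ind _) A⊆ B⊆ (trans ∣A∣≡ (sym ∣B∣≡))
  jumps-along {k} {ℱ} {i} ind size (there {j = j} (_ , ∣ℱi∩ℱj∣≥) path) A⊆ ∣A∣≡ B⊆ ∣B∣≡
    with ∃-⊆-∣∣≡ (lookup ℱ j) (suc k) (size j)
  ... | M , M⊆ , ∣M∣≡ =
    jumps-across (ind i) (ind j) (size i) (size j) ∣ℱi∩ℱj∣≥ A⊆ ∣A∣≡ M⊆ ∣M∣≡
    ◅◅ jumps-along ind size path M⊆ ∣M∣≡ B⊆ ∣B∣≡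

lemma7p1 : ∀ {n} (G : Graph n) (k : ℕ) → k ≥ 1 →
    (S T : Subset n) → Independent G S → Independent G T →
    ∣ S ∣ ≡ k → ∣ T ∣ ≡ k →
    (ℱ : List (Subset n)) →
    (∀ (i : Fin (length ℱ)) → Independent G (lookup ℱ i)) →
    (∀ (i : Fin (length ℱ)) → ∣ lookup ℱ i ∣ ≥ k) →
    (iₛ iₜ : Fin (length ℱ)) → lookup ℱ iₛ ≡ S → lookup ℱ iₜ ≡ T →
    𝒢Path k ℱ iₛ iₜ →
    TJSeq G S T
lemma7p1 G (suc k) _ S T _ _ ∣S∣≡k ∣T∣≡k ℱ ind size iₛ iₜ ℱiₛ≡S ℱiₜ≡T path =
  fold (TJSeq G) step done
    (jumps-along G ind size path (⊆-reflexive (sym ℱiₛ≡S)) ∣S∣≡k (⊆-reflexive (sym ℱiₜ≡T)) ∣T∣≡k)
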